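{- Let $\mathbf P=(P,\leq,{}',0,1)$ be a poset with complementation. Then the Dedekind-MacNeille completion $\mathrm{DM}(\mathbf P)$ is orthomodular if and only if $\mathbf P$ is a strongly $D$-continuous pseudo-orthomodular poset.
   Context: For $M\subseteq P$, $U(M)$, $L(M)$ denote the sets of upper and lower bounds of $M$ in $P$. A poset with complementation is a bounded poset with an antitone involution $'$ ($x\leq y\Rightarrow y'\leq x'$, $x''=x$) such that $L(x,x')=\{0\}$, $U(x,x')=\{1\}$. It is pseudo-orthomodular if $L(U(L(x,y),y'),y)=L(x,y)$ for all $x,y$. For $B,C\subseteq P$, write $B\leq C$ if $b\leq c$ for all $b\in B,c\in C$. $\mathbf P$ is strongly $D$-continuous if for all $B,C\subseteq P$ with $B\leq C$: the infimum in $\mathbf P$ of $\{g\in P\mid g\in C\text{ or }g'\in B\}$ exists and equals $0$ if and only if every lower bound of $C$ is below every upper bound of $B$. The Dedekind-MacNeille completion $\mathrm{DM}(\mathbf P)$ is the complete lattice $(\{B\subseteq P\mid L(U(B))=B\},\subseteq)$ with $P$ embedded via $x\mapsto L(x)$ and complementation $X\mapsto L(\{x'\mid x\in X\})$; a lattice with complementation is orthomodular if $x\vee y=((x\vee y)\wedge y')\vee y$. -}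

module Defs where

open import Level using (Level; suc)
open import Data.Product using (_×_; ∃-syntax; _,_)
open import Data.Sum using (_⊎_)
open import Relation.Binary.Core using (Rel)
open import Relation.Binary.Structures using (IsPartialOrder)
open import Relation.Binary.PropositionalEquality using (_≡_)
open import Relation.Unary using (Pred; _∪_; _∩_; _⊆_; _≐_)
open import Function.Bundles using (_⇔_)

record PosetWithComplementation (ℓ : Level) : Set (suc ℓ) where
  infix 4 _≤_
  field
    Carrier        : Set ℓ
    _≤_            : Rel Carrier ℓ
    isPartialOrder : IsPartialOrder _≡_ _≤_
    𝟘 𝟙            : Carrier
    𝟘-least        : ∀ x → 𝟘 ≤ x
    𝟙-greatest     : ∀ x → x ≤ 𝟙
    _′             : Carrier → Carrier
    antitone       : ∀ {x y} → x ≤ y → y ′ ≤ x ′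
    involutive     : ∀ x → (x ′) ′ ≡ x
    L-compl        : ∀ x z → z ≤ x → z ≤ x ′ → z ≡ 𝟘
    U-compl        : ∀ x z → x ≤ z → x ′ ≤ z → z ≡ 𝟙

module _ {ℓ : Level} (𝐏 : PosetWithComplementation ℓ) where
  open PosetWithComplementation 𝐏

  Subset : Set (suc ℓ)
  Subset = Pred Carrier ℓ

  L : Subset → Subset
  L B = λ x → ∀ y → B y → x ≤ y

  U : Subset → Subset
  U B = λ x → ∀ y → B y → y ≤ x

  ｛_｝ : Carrier → Subset
  ｛ x ｝ = λ z → z ≡ x

  ｛_⸴_｝ : Carrier → Carrier → Subset
  ｛ x ⸴ y ｝ = λ z → z ≡ x ⊎ z ≡ y

  _≤ˢ_ : Subset → Subset → Set ℓ
  B ≤ˢ C = ∀ b c → B b → C c → b ≤ c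

  IsInfimum : Subset → Carrier → Set ℓ
  IsInfimum G a = L G a × (∀ x → L G x → x ≤ a)

  PseudoOrthomodular : Set ℓ
  PseudoOrthomodular = ∀ x y →
    L (U (L ｛ x ⸴ y ｝ ∪ ｛ y ′ ｝) ∪ ｛ y ｝) ≐ L ｛ x ⸴ y ｝

  StronglyDContinuous : Set (suc ℓ)
  StronglyDContinuous = ∀ (B C : Subset) → B ≤ˢ C →
    (IsInfimum (λ g → C g ⊎ B (g ′)) 𝟘 ⇔ (L C ≤ˢ U B))

  -- Dedekind–MacNeille completion: closed subsets X = L(U(X))
  IsClosed : Subset → Set ℓ
  IsClosed X = L (U X) ≐ X

  _∧ᴰᴹ_ : Subset → Subset → Subset
  X ∧ᴰᴹ Y = X ∩ Y

  _∨ᴰᴹ_ : Subset → Subset → Subset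
  X ∨ᴰᴹ Y = L (U (X ∪ Y))

  _⊥ᴰᴹ : Subset → Subset
  X ⊥ᴰᴹ = L (λ z → ∃[ x ] (X x × z ≡ x ′))

  DMOrthomodular : Set (suc ℓ)
  DMOrthomodular = ∀ (X Y : Subset) → IsClosed X → IsClosed Y →
    (X ∨ᴰᴹ Y) ≐ (((X ∨ᴰᴹ Y) ∧ᴰᴹ (Y ⊥ᴰᴹ)) ∨ᴰᴹ Y)

module Submission where

-- The whole argument rests on one consequence of orthomodularity in DM(P),
-- the cancellation law: if X ⊆ Z are closed and Z ∧ X⊥ = 0, then Z = X
-- (indeed Z = Z ∨ X = ((Z ∨ X) ∧ X⊥) ∨ X = 0 ∨ X = X).
--  * Pseudo-orthomodularity is cancellation for X = L(x,y) ⊆ Z = L(U(L(x,y),y′),y).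
--  * Strong D-continuity: its "if" half holds in every poset with
--    complementation (a lower bound x of {g | g ∈ C or g′ ∈ B} satisfies
--    x ≤ x′, hence x = 0); its "only if" half is cancellation for
--    L(U(B)) ⊆ L(C).
--  * Conversely, strong D-continuity alone makes DM(P) orthomodular: for
--    Z = X ∨ Y and W = (Z ∧ Y⊥) ∨ Y ⊆ Z, apply it to B = W, C = U(X ∪ Y).

open import Defs using (PosetWithComplementation; DMOrthomodular; StronglyDContinuous; PseudoOrthomodular)
import Defs
open import Level using (Level)
open import Data.Product using (_×_; _,_; proj₁)
open import Data.Sum using (_⊎_; inj₁; inj₂; [_,_])
open import Function.Base using (id)
open import Function.Bundles using (_⇔_; mk⇔; Equivalence)
open import Relation.Binary.PropositionalEquality using (_≡_; refl; subst; sym)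
open import Relation.Binary.Structures using (IsPartialOrder)
open import Relation.Unary using (_∪_; _⊆_)

module DedekindMacNeille {ℓ : Level} (𝐏 : PosetWithComplementation ℓ) where
  open PosetWithComplementation 𝐏
  open IsPartialOrder isPartialOrder using (antisym; reflexive) renaming (refl to ≤-refl)

  Subset : Set (Level.suc ℓ)
  Subset = Defs.Subset 𝐏

  L U : Subset → Subset
  L = Defs.L 𝐏
  U = Defs.U 𝐏

  ｛_｝ : Carrier → Subset
  ｛_｝ = Defs.｛_｝ 𝐏

  ｛_⸴_｝ : Carrier → Carrier → Subset
  ｛_⸴_｝ = Defs.｛_⸴_｝ 𝐏

  _≤ˢ_ : Subset → Subset → Set ℓ
  _≤ˢ_ = Defs._≤ˢ_ 𝐏

  IsInfimum : Subset → Carrier → Set ℓ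
  IsInfimum = Defs.IsInfimum 𝐏

  IsClosed : Subset → Set ℓ
  IsClosed = Defs.IsClosed 𝐏

  _∧ᴰᴹ_ _∨ᴰᴹ_ : Subset → Subset → Subset
  _∧ᴰᴹ_ = Defs._∧ᴰᴹ_ 𝐏
  _∨ᴰᴹ_ = Defs._∨ᴰᴹ_ 𝐏

  _⊥ᴰᴹ : Subset → Subset
  _⊥ᴰᴹ = Defs._⊥ᴰᴹ 𝐏

  𝒢 : Subset → Subset → Subset
  𝒢 B C = λ g → C g ⊎ B (g ′)

  ≤′-swap : ∀ {x y} → x ≤ y ′ → y ≤ x ′
  ≤′-swap {x} {y} x≤y′ = subst (λ t → t ≤ x ′) (involutive y) (antitone x≤y′)

  ≤′-self⇒𝟘 : ∀ {x} → x ≤ x ′ → x ≡ 𝟘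
  ≤′-self⇒𝟘 {x} = L-compl x x ≤-refl

  L-antitone : ∀ {S T} → S ⊆ T → L T ⊆ L S
  L-antitone S⊆T x∈LT s s∈S = x∈LT s (S⊆T s∈S)

  ⊆LU : ∀ {S} → S ⊆ L (U S)
  ⊆LU {x = x} x∈S u u∈US = u∈US x x∈S

  L-closed : ∀ S → IsClosed (L S)
  L-closed S = (λ x∈LULS s s∈S → x∈LULS s (λ t t∈LS → t∈LS s s∈S)) , ⊆LU

  𝟘∈closed : ∀ {X} → IsClosed X → X 𝟘
  𝟘∈closed cX = proj₁ cX (λ u _ → 𝟘-least u)

  ∨-upperˡ : ∀ {X Y} → X ⊆ X ∨ᴰᴹ Y
  ∨-upperˡ x∈X = ⊆LU (inj₁ x∈X)

  ∨-upperʳ : ∀ {X Y} → Y ⊆ X ∨ᴰᴹ Y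
  ∨-upperʳ y∈Y = ⊆LU (inj₂ y∈Y)

  ∨-least : ∀ {X Y Z} → IsClosed Z → X ⊆ Z → Y ⊆ Z → X ∨ᴰᴹ Y ⊆ Z
  ∨-least cZ X⊆Z Y⊆Z w∈X∨Y =
    proj₁ cZ (λ u u∈UZ → w∈X∨Y u λ _ → [ (λ t∈X → u∈UZ _ (X⊆Z t∈X)) , (λ t∈Y → u∈UZ _ (Y⊆Z t∈Y)) ])

  ⊥ᴰᴹ-intro : ∀ {X w} → (∀ x → X x → w ≤ x ′) → (X ⊥ᴰᴹ) w
  ⊥ᴰᴹ-intro w≤X′ _ (x , x∈X , refl) = w≤X′ x x∈X

  ⊥ᴰᴹ-elim : ∀ {X w} → (X ⊥ᴰᴹ) w → ∀ x → X x → w ≤ x ′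
  ⊥ᴰᴹ-elim w∈X⊥ x x∈X = w∈X⊥ (x ′) (x , x∈X , refl)

  orthomodular-cancel : DMOrthomodular 𝐏 → ∀ {X Z} → IsClosed X → IsClosed Z → X ⊆ Z →
                        (∀ {w} → Z w → (X ⊥ᴰᴹ) w → w ≡ 𝟘) → Z ⊆ X
  orthomodular-cancel om {X} {Z} cX cZ X⊆Z disjoint z∈Z =
    ∨-least cX residue⊆X id (proj₁ (om Z X cZ cX) (∨-upperˡ z∈Z))
    where
      -- (Z ∨ X) ∧ X⊥ = Z ∧ X⊥ = 0
      residue⊆X : (Z ∨ᴰᴹ X) ∧ᴰᴹ (X ⊥ᴰᴹ) ⊆ X
      residue⊆X (w∈Z∨X , w∈X⊥) =
        subst X (sym (disjoint (∨-least cZ id X⊆Z w∈Z∨X) w∈X⊥)) (𝟘∈closed cX)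

  DMOrthomodular⇒PseudoOrthomodular : DMOrthomodular 𝐏 → PseudoOrthomodular 𝐏
  DMOrthomodular⇒PseudoOrthomodular om x y =
    orthomodular-cancel om (L-closed _) (L-closed _) M⊆Z disjoint , M⊆Z
    where
      M Z : Subset
      M = L ｛ x ⸴ y ｝
      Z = L (U (M ∪ ｛ y ′ ｝) ∪ ｛ y ｝)

      M⊆Z : M ⊆ Z
      M⊆Z w∈M t (inj₁ t∈U) = t∈U _ (inj₁ w∈M)
      M⊆Z w∈M t (inj₂ refl) = w∈M t (inj₂ refl)

      -- w ∈ Z ∧ M⊥ makes w′ an upper bound of M ∪ {y′}, so w ≤ w′.
      disjoint : ∀ {w} → Z w → (M ⊥ᴰᴹ) w → w ≡ 𝟘
      disjoint {w} w∈Z w∈M⊥ = ≤′-self⇒𝟘 (w∈Z (w ′) (inj₁ w′∈U))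
        where
          w′∈U : U (M ∪ ｛ y ′ ｝) (w ′)
          w′∈U s (inj₁ s∈M) = ≤′-swap (⊥ᴰᴹ-elim w∈M⊥ s s∈M)
          w′∈U s (inj₂ refl) = antitone (w∈Z y (inj₂ refl))

  𝒢-lower⇒L : ∀ B C {x} → L (𝒢 B C) x → L C x
  𝒢-lower⇒L B C x∈L𝒢 c c∈C = x∈L𝒢 c (inj₁ c∈C)

  𝒢-lower⇒≤′ : ∀ B C {x} → L (𝒢 B C) x → ∀ b → B b → x ≤ b ′
  𝒢-lower⇒≤′ B C x∈L𝒢 b b∈B = x∈L𝒢 (b ′) (inj₂ (subst B (sym (involutive b)) b∈B))

  𝟘-infimum : ∀ {G} → (∀ x → L G x → x ≤ x ′) → IsInfimum G 𝟘
  𝟘-infimum below-own-complement =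
    (λ g _ → 𝟘-least g) , λ x x∈LG → reflexive (≤′-self⇒𝟘 (below-own-complement x x∈LG))

  separated⇒𝟘-infimum : ∀ {B C} → L C ≤ˢ U B → IsInfimum (𝒢 B C) 𝟘
  separated⇒𝟘-infimum {B} {C} LC≤UB = 𝟘-infimum λ x x∈L𝒢 →
    LC≤UB x (x ′) (𝒢-lower⇒L B C x∈L𝒢) (λ b b∈B → ≤′-swap (𝒢-lower⇒≤′ B C x∈L𝒢 b b∈B))

  -- The "only if" half is cancellation for L(U(B)) ⊆ L(C): an element of
  -- L(C) ∧ L(U(B))⊥ is a lower bound of 𝒢 B C, hence 0.
  𝟘-infimum⇒separated : DMOrthomodular 𝐏 → ∀ {B C} → B ≤ˢ C → IsInfimum (𝒢 B C) 𝟘 → L C ≤ˢ U B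
  𝟘-infimum⇒separated om {B} {C} B≤C (_ , below-𝟘) x u x∈LC u∈UB =
    orthomodular-cancel om (L-closed (U B)) (L-closed C) LUB⊆LC disjoint x∈LC u u∈UB
    where
      LUB⊆LC : L (U B) ⊆ L C
      LUB⊆LC = L-antitone (λ c∈C b b∈B → B≤C b _ b∈B c∈C)

      disjoint : ∀ {w} → L C w → (L (U B) ⊥ᴰᴹ) w → w ≡ 𝟘
      disjoint {w} w∈LC w∈⊥ = antisym (below-𝟘 w w∈L𝒢) (𝟘-least w)
        where
          w∈L𝒢 : L (𝒢 B C) w
          w∈L𝒢 g = [ w∈LC g , (λ g′∈B → subst (w ≤_) (involutive g) (⊥ᴰᴹ-elim w∈⊥ (g ′) (⊆LU g′∈B))) ]

  DMOrthomodular⇒StronglyDContinuous : DMOrthomodular 𝐏 → StronglyDContinuous 𝐏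
  DMOrthomodular⇒StronglyDContinuous om B C B≤C =
    mk⇔ (𝟘-infimum⇒separated om B≤C) separated⇒𝟘-infimum

  StronglyDContinuous⇒DMOrthomodular : StronglyDContinuous 𝐏 → DMOrthomodular 𝐏
  StronglyDContinuous⇒DMOrthomodular sdc X Y _ _ = Z⊆W , W⊆Z
    where
      C Z A W : Subset
      C = U (X ∪ Y)
      Z = X ∨ᴰᴹ Y
      A = Z ∧ᴰᴹ (Y ⊥ᴰᴹ)
      W = A ∨ᴰᴹ Y

      W⊆Z : W ⊆ Z
      W⊆Z = ∨-least (L-closed C) proj₁ ∨-upperʳ

      W≤C : W ≤ˢ C
      W≤C _ c w∈W c∈C = W⊆Z w∈W c c∈C

      -- A lower bound x of 𝒢 W C lies in Z and in Y⊥ (as Y ⊆ W), so x ∈ A ⊆ W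
      -- and therefore x ≤ x′.
      W-gap : IsInfimum (𝒢 W C) 𝟘
      W-gap = 𝟘-infimum λ x x∈L𝒢 →
        let x∈Y⊥ : (Y ⊥ᴰᴹ) x
            x∈Y⊥ = ⊥ᴰᴹ-intro (λ y y∈Y → 𝒢-lower⇒≤′ W C x∈L𝒢 y (∨-upperʳ {A} y∈Y))
        in 𝒢-lower⇒≤′ W C x∈L𝒢 x (∨-upperˡ {A} {Y} (𝒢-lower⇒L W C x∈L𝒢 , x∈Y⊥))

      -- Hence L(C) ≤ U(W); every upper bound of A ∪ Y is one of W.
      Z⊆W : Z ⊆ W
      Z⊆W z∈Z t t∈U = Equivalence.to (sdc W C W≤C) W-gap _ t z∈Z (λ w w∈W → w∈W t t∈U)

theorem9 : {ℓ : Level} (𝐏 : PosetWithComplementation ℓ) →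
    DMOrthomodular 𝐏 ⇔ (StronglyDContinuous 𝐏 × PseudoOrthomodular 𝐏)
theorem9 𝐏 = mk⇔
  (λ om → DMOrthomodular⇒StronglyDContinuous om , DMOrthomodular⇒PseudoOrthomodular om)
  (λ (sdc , _) → StronglyDContinuous⇒DMOrthomodular sdc)
  where open DedekindMacNeille 𝐏
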